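{- If a binary CSP instance satisfies the $\forall\exists$ broken-triangle property ($\forall\exists$BTP) on variable $x_m$, then it satisfies the BT-degree property on variable $x_m$.
   Context: A binary CSP instance $I=\langle X,\mathcal{D},R\rangle$ consists of a finite set $X$ of variables, a finite domain $\mathcal{D}(x_i)$ for each variable, and for each ordered pair of distinct variables $(x_i,x_j)$ a relation $R_{ij}\subseteq \mathcal{D}(x_i)\times\mathcal{D}(x_j)$, with $R_{ji}$ the transpose of $R_{ij}$. An assignment to distinct variables is consistent if each value lies in its variable's domain and every pair of assigned values satisfies the corresponding relation. For distinct $x_i,x_j,x_m$, a broken triangle $(u',v_i,v_j,u'')$ on $x_m$ consists of $v_i\in\mathcal{D}(x_i)$, $v_j\in\mathcal{D}(x_j)$ (the base) and $u',u''\in\mathcal{D}(x_m)$ (the apexes) with $(v_i,v_j)\in R_{ij}$, $(v_i,u')\in R_{im}$, $(v_j,u'')\in R_{jm}$, $(v_i,u'')\notin R_{im}$ and $(v_j,u')\notin R_{jm}$. $I$ satisfies $\forall\exists$BTP on $x_m$ if for all $i\neq m$ and all $v_1\in\mathcal{D}(x_i)$ there exists $v_m\in\mathcal{D}(x_m)$ such that $(v_1,v_m)\in R_{im}$ and for all $j\notin\{i,m\}$ and all $v_2\in\mathcal{D}(x_j)$ there is no broken triangle on $x_m$ with base the assignment $\langle v_1,v_2\rangle$ to $\langle x_i,x_j\rangle$ having $v_m$ as one of its apexes. The BT degree of $(v_i,u)$ with $v_i\in\mathcal{D}(x_i)$, $u\in\mathcal{D}(x_m)$ is the number of distinct variables $x_j$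 ($j\neq i,m$) for which some $v_j\in\mathcal{D}(x_j)$ and $u'\in\mathcal{D}(x_m)$ give a broken triangle on $x_m$ with base $\langle v_i,v_j\rangle$ and apexes $u,u'$. A consistent $\langle v_i,v_j\rangle$ is 3-safe on $x_m$ if for every broken triangle $(u',v_i,v_j,u'')$ on $x_m$, the BT degree of $(v_i,u'')$ or of $(v_j,u')$ is one. $I$ satisfies the BT-degree property on $x_m$ if for all distinct $i,j\neq m$ and all consistent $\langle v_i,v_j\rangle$ to $\langle x_i,x_j\rangle$, there exists $v_m\in\mathcal{D}(x_m)$ with $\langle v_i,v_j,v_m\rangle$ consistent and such that either $\langle v_i,v_j\rangle$ is 3-safe on $x_m$, or $(v_i,v_m)$ has BT degree zero, or $(v_j,v_m)$ has BT degree zero. -}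

module Defs where

open import Data.Nat using (ℕ)
open import Data.Fin using (Fin; _≟_)
open import Data.Fin.Properties using (any?)
open import Data.Bool using (Bool; true; false; T)
open import Data.Product using (Σ; ∃; _×_; _,_)
open import Data.List using (List; length; filter; allFin)
open import Relation.Nullary using (¬_; Dec; yes; no)
open import Relation.Nullary.Decidable using (_×-dec_; _⊎-dec_; ¬?)
open import Data.Sum using (_⊎_)
open import Relation.Binary.PropositionalEquality using (_≡_; _≢_)

-- Relations are only meaningful for distinct i, j; R_ji is the transpose of R_ij.
record CSP : Set where
  field
    n     : ℕ
    dom   : Fin n → ℕ
    R     : (i j : Fin n) → Fin (dom i) → Fin (dom j) → Bool
    R-sym : ∀ i j → i ≢ j → ∀ a b → R j i b a ≡ R i j a b

module _ (I : CSP) where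
  open CSP I

  Var : Set
  Var = Fin n

  D : Var → Set
  D i = Fin (dom i)

  Rel : (i j : Var) → D i → D j → Set
  Rel i j a b = T (R i j a b)

  Rel? : (i j : Var) → (a : D i) → (b : D j) → Dec (Rel i j a b)
  Rel? i j a b with R i j a b
  ... | true  = yes _
  ... | false = no (λ ())

  BT : (m i j : Var) → D m → D i → D j → D m → Set
  BT m i j u′ vi vj u″ =
    Rel i j vi vj × Rel i m vi u′ × Rel j m vj u″ ×
    ¬ Rel i m vi u″ × ¬ Rel j m vj u′

  BT? : ∀ m i j u′ vi vj u″ → Dec (BT m i j u′ vi vj u″)
  BT? m i j u′ vi vj u″ =
    Rel? i j vi vj ×-dec Rel? i m vi u′ ×-dec Rel? j m vj u″ ×-dec
    ¬? (Rel? i m vi u″) ×-dec ¬? (Rel? j m vj u′)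

  ForallExistsBTP : Var → Set
  ForallExistsBTP m =
    ∀ (i : Var) → i ≢ m → ∀ (v₁ : D i) →
    Σ (D m) λ vm → Rel i m v₁ vm ×
      (∀ (j : Var) → j ≢ i → j ≢ m → ∀ (v₂ : D j) → ∀ (u : D m) →
        ¬ BT m i j vm v₁ v₂ u × ¬ BT m i j u v₁ v₂ vm)

  HasBTWith : (m i : Var) → D i → D m → Var → Set
  HasBTWith m i vi u j =
    (j ≢ i) × (j ≢ m) × ∃ λ (vj : D j) → ∃ λ (u′ : D m) →
      (BT m i j u vi vj u′ ⊎ BT m i j u′ vi vj u)

  HasBTWith? : ∀ m i vi u j → Dec (HasBTWith m i vi u j)
  HasBTWith? m i vi u j =
    ¬? (j ≟ i) ×-dec ¬? (j ≟ m) ×-dec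
    any? (λ vj → any? (λ u′ → BT? m i j u vi vj u′ ⊎-dec BT? m i j u′ vi vj u))

  BTdegree : (m i : Var) → D i → D m → ℕ
  BTdegree m i vi u = length (filter (HasBTWith? m i vi u) (allFin n))

  ThreeSafe : (m i j : Var) → D i → D j → Set
  ThreeSafe m i j vi vj =
    Rel i j vi vj ×
    (∀ (u′ u″ : D m) → BT m i j u′ vi vj u″ →
      (BTdegree m i vi u″ ≡ 1) ⊎ (BTdegree m j vj u′ ≡ 1))

  BTDegreeProperty : Var → Set
  BTDegreeProperty m =
    ∀ (i j : Var) → i ≢ j → i ≢ m → j ≢ m →
    ∀ (vi : D i) (vj : D j) → Rel i j vi vj →
    Σ (D m) λ vm →
      (Rel i m vi vm × Rel j m vj vm) ×
      (ThreeSafe m i j vi vj ⊎ (BTdegree m i vi vm ≡ 0) ⊎ (BTdegree m j vj vm ≡ 0))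

-- The value that ∀∃BTP supplies for vᵢ is the apex of no broken triangle with base vᵢ, so its
-- BT degree is zero; likewise for vⱼ. If neither of the two values extends ⟨vᵢ , vⱼ⟩, then
-- together they form a broken triangle on xₘ with base ⟨vᵢ , vⱼ⟩, which ∀∃BTP forbids.
module Submission where

open import Defs
open import Data.Fin using (Fin)
open import Data.List using (length; allFin)
open import Data.List.Properties using (filter-none)
open import Data.List.Relation.Unary.All using (universal)
open import Data.Product using (_×_; _,_)
open import Data.Sum using (_⊎_; inj₁; inj₂)
open import Data.Empty using (⊥; ⊥-elim)
open import Relation.Nullary using (¬_; yes; no)
open import Relation.Binary.PropositionalEquality using (_≡_; _≢_; cong; ≢-sym)

module _ (I : CSP) (m : Var I) where

  BTdegree≡0 : ∀ {i} {vi : D I i} {u : D I m} →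
    (∀ j → ¬ HasBTWith I m i vi u j) → BTdegree I m i vi u ≡ 0
  BTdegree≡0 {i} {vi} {u} noBT =
    cong length (filter-none (HasBTWith? I m i vi u) (universal noBT (allFin (CSP.n I))))

  module _ (btp : ForallExistsBTP I m) where

    support : ∀ i → i ≢ m → D I i → D I m
    support i i≢m vi with btp i i≢m vi
    ... | vm , _ = vm

    support-rel : ∀ i (i≢m : i ≢ m) vi → Rel I i m vi (support i i≢m vi)
    support-rel i i≢m vi with btp i i≢m vi
    ... | _ , rel , _ = rel

    support-noBT : ∀ i (i≢m : i ≢ m) vi j → j ≢ i → j ≢ m → ∀ vj u →
      ¬ BT I m i j (support i i≢m vi) vi vj u × ¬ BT I m i j u vi vj (support i i≢m vi)
    support-noBT i i≢m vi with btp i i≢m vi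
    ... | _ , _ , noBT = noBT

    support-BTdegree≡0 : ∀ i (i≢m : i ≢ m) vi → BTdegree I m i vi (support i i≢m vi) ≡ 0
    support-BTdegree≡0 i i≢m vi = BTdegree≡0 noBT
      where
      noBT : ∀ j → ¬ HasBTWith I m i vi (support i i≢m vi) j
      noBT j (j≢i , j≢m , vj , u , inj₁ bt) with support-noBT i i≢m vi j j≢i j≢m vj u
      ... | noBT₁ , _ = noBT₁ bt
      noBT j (j≢i , j≢m , vj , u , inj₂ bt) with support-noBT i i≢m vi j j≢i j≢m vj u
      ... | _ , noBT₂ = noBT₂ bt

    supports-not-both-unrelated : ∀ {i j} (i≢j : i ≢ j) (i≢m : i ≢ m) (j≢m : j ≢ m) {vi vj} →
      Rel I i j vi vj →
      ¬ Rel I j m vj (support i i≢m vi) → ¬ Rel I i m vi (support j j≢m vj) → ⊥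
    supports-not-both-unrelated {i} {j} i≢j i≢m j≢m {vi} {vj} rel ¬rⱼ ¬rᵢ
      with support-noBT i i≢m vi j (≢-sym i≢j) j≢m vj (support j j≢m vj)
    ... | noBT , _ =
      noBT (rel , support-rel i i≢m vi , support-rel j j≢m vj , ¬rᵢ , ¬rⱼ)

proposition5 : (I : CSP) → (m : Fin (CSP.n I)) →
    ForallExistsBTP I m → BTDegreeProperty I m
proposition5 I m btp i j i≢j i≢m j≢m vi vj rel
  with Rel? I j m vj (support I m btp i i≢m vi) | Rel? I i m vi (support I m btp j j≢m vj)
... | yes rⱼ | _ =
  support I m btp i i≢m vi , (support-rel I m btp i i≢m vi , rⱼ) ,
  inj₂ (inj₁ (support-BTdegree≡0 I m btp i i≢m vi))
... | no _ | yes rᵢ =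
  support I m btp j j≢m vj , (rᵢ , support-rel I m btp j j≢m vj) ,
  inj₂ (inj₂ (support-BTdegree≡0 I m btp j j≢m vj))
... | no ¬rⱼ | no ¬rᵢ =
  ⊥-elim (supports-not-both-unrelated I m btp i≢j i≢m j≢m rel ¬rⱼ ¬rᵢ)
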